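{- For any $\lambda^{\Box\rightarrow\wedge\vee}$-terms $t,s$, if $t>_P s$ then $\#t=\#s$.
   Context: Terms of $\lambda^{\Box\rightarrow\wedge\vee}$: $x\mid \lambda x.t\mid ts\mid \langle t,s\rangle\mid \pi_1 t\mid \pi_2 t\mid \mathsf{in}_1 t\mid \mathsf{in}_2 t\mid \mathsf{C}_{x,y}(t,t_1,t_2)\mid \mathsf{B}_{x_1,\dots,x_n}(t_1,\dots,t_n)\,\mathsf{in}\,s$. Permutations $>_P$ (closed under term contexts): $\mathsf{C}_{x,y}(t,t_1,t_2)s>\mathsf{C}_{x,y}(t,t_1s,t_2s)$; $\pi_i\mathsf{C}_{x,y}(t,t_1,t_2)>\mathsf{C}_{x,y}(t,\pi_it_1,\pi_it_2)$; $\mathsf{C}_{u,v}(\mathsf{C}_{x,y}(t,t_1,t_2),s_1,s_2)>\mathsf{C}_{x,y}(t,\mathsf{C}_{u,v}(t_1,s_1,s_2),\mathsf{C}_{u,v}(t_2,s_1,s_2))$; $\mathsf{B}_{\vec x}(t_1,\dots,t_{i-1},\mathsf{C}_{x,y}(t,s_1,s_2),t_{i+1},\dots,t_n)\,\mathsf{in}\,s>\mathsf{C}_{x,y}(t,\mathsf{B}_{\vec x}(t_1,\dots,s_1,\dots,t_n)\,\mathsf{in}\,s,\ \mathsf{B}_{\vec x}(t_1,\dots,s_2,\dots,t_n)\,\mathsf{in}\,s)$. The function $\#$ on terms: $\#x=1$; $\#\lambda x.t=1$; $\#(ts)=\#t$; $\#\langle t,s\rangle=1$; $\#\pi_it=\#t$;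 $\#\mathsf{in}_it=1$; $\#\mathsf{C}_{x,y}(t,t_1,t_2)=2\cdot\#t\cdot(\#t_1+\#t_2)$; $\#(\mathsf{B}_{x_1,\dots,x_n}(t_1,\dots,t_n)\,\mathsf{in}\,s)=\#s\cdot\prod_{i=1}^n\#t_i$. -}

module Defs where

open import Data.Nat using (ℕ; _+_; _*_)
open import Data.List using (List; []; _∷_; _++_)
open import Data.Product using (_×_; _,_)

Var : Set
Var = ℕ

-- Raw terms of λ^{□→∧∨}.  B xs s stands for B_{x1..xn}(t1..tn) in s,
-- where xs = (x1 , t1) ∷ … ∷ (xn , tn).
data Term : Set where
  var  : Var → Term
  lam  : Var → Term → Term
  app  : Term → Term → Term
  pair : Term → Term → Term
  π₁ π₂ : Term → Term
  in₁ in₂ : Term → Term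
  C    : Var → Var → Term → Term → Term → Term
  B    : List (Var × Term) → Term → Term

mutual
  # : Term → ℕ
  # (var x) = 1
  # (lam x t) = 1
  # (app t s) = # t
  # (pair t s) = 1
  # (π₁ t) = # t
  # (π₂ t) = # t
  # (in₁ t) = 1
  # (in₂ t) = 1
  # (C x y t t₁ t₂) = 2 * # t * (# t₁ + # t₂)
  # (B xs s) = # s * #prod xs

  #prod : List (Var × Term) → ℕ
  #prod [] = 1
  #prod ((x , t) ∷ xs) = # t * #prod xs

mutual
  data _>P_ : Term → Term → Set where
    p-app : ∀ {x y t t₁ t₂ s} →
      app (C x y t t₁ t₂) s >P C x y t (app t₁ s) (app t₂ s)
    p-π₁ : ∀ {x y t t₁ t₂} →
      π₁ (C x y t t₁ t₂) >P C x y t (π₁ t₁) (π₁ t₂)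
    p-π₂ : ∀ {x y t t₁ t₂} →
      π₂ (C x y t t₁ t₂) >P C x y t (π₂ t₁) (π₂ t₂)
    p-C : ∀ {u v x y t t₁ t₂ s₁ s₂} →
      C u v (C x y t t₁ t₂) s₁ s₂ >P C x y t (C u v t₁ s₁ s₂) (C u v t₂ s₁ s₂)
    p-B : ∀ {pre post z x y t s₁ s₂ s} →
      B (pre ++ (z , C x y t s₁ s₂) ∷ post) s
        >P C x y t (B (pre ++ (z , s₁) ∷ post) s) (B (pre ++ (z , s₂) ∷ post) s)
    c-lam : ∀ {x t t'} → t >P t' → lam x t >P lam x t'
    c-appˡ : ∀ {t t' s} → t >P t' → app t s >P app t' s
    c-appʳ : ∀ {t s s'} → s >P s' → app t s >P app t s'
    c-pairˡ : ∀ {t t' s} → t >P t' → pair t s >P pair t' s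
    c-pairʳ : ∀ {t s s'} → s >P s' → pair t s >P pair t s'
    c-π₁ : ∀ {t t'} → t >P t' → π₁ t >P π₁ t'
    c-π₂ : ∀ {t t'} → t >P t' → π₂ t >P π₂ t'
    c-in₁ : ∀ {t t'} → t >P t' → in₁ t >P in₁ t'
    c-in₂ : ∀ {t t'} → t >P t' → in₂ t >P in₂ t'
    c-C₀ : ∀ {x y t t' t₁ t₂} → t >P t' → C x y t t₁ t₂ >P C x y t' t₁ t₂
    c-C₁ : ∀ {x y t t₁ t₁' t₂} → t₁ >P t₁' → C x y t t₁ t₂ >P C x y t t₁' t₂
    c-C₂ : ∀ {x y t t₁ t₂ t₂'} → t₂ >P t₂' → C x y t t₁ t₂ >P C x y t t₁ t₂'
    c-Bᵢ : ∀ {xs xs' s} → xs >Pᴸ xs' → B xs s >P B xs' s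
    c-Bin : ∀ {xs s s'} → s >P s' → B xs s >P B xs s'

  data _>Pᴸ_ : List (Var × Term) → List (Var × Term) → Set where
    here  : ∀ {x t t' xs} → t >P t' → ((x , t) ∷ xs) >Pᴸ ((x , t') ∷ xs)
    there : ∀ {p xs xs'} → xs >Pᴸ xs' → (p ∷ xs) >Pᴸ (p ∷ xs')

-- # of a C-term is 2·#t times the sum of the #'s of its branches, and # is
-- multiplicative in every position from which a permutation pulls a C-term
-- outward (applications, projections, scrutinees of C, bound terms of B).
-- So each root permutation only distributes a product over that sum, and the
-- congruence cases hold because # sees subterms only through their #.
module Submission where

open import Defs

open import Data.List using ([]; _∷_; _++_)
open import Data.Nat using (ℕ; _+_; _*_)
open import Data.Nat.Properties using (+-identityʳ; *-assoc)
open import Data.Nat.Tactic.RingSolver using (solve)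
open import Data.Product using (_,_)
open import Relation.Binary.PropositionalEquality
  using (_≡_; refl; sym; trans; cong; cong₂; module ≡-Reasoning)

#prod-++ : ∀ xs ys → #prod (xs ++ ys) ≡ #prod xs * #prod ys
#prod-++ []             ys = sym (+-identityʳ (#prod ys))
#prod-++ ((x , t) ∷ xs) ys =
  trans (cong (# t *_) (#prod-++ xs ys)) (sym (*-assoc (# t) (#prod xs) (#prod ys)))

#-B-plug : ∀ pre z u post s →
           # (B (pre ++ (z , u) ∷ post) s) ≡ # u * (# s * (#prod pre * #prod post))
#-B-plug pre z u post s = begin
  # s * #prod (pre ++ (z , u) ∷ post)    ≡⟨ cong (# s *_) (#prod-++ pre ((z , u) ∷ post)) ⟩
  # s * (#prod pre * (# u * #prod post)) ≡⟨ rearrange (# s) (#prod pre) (# u) (#prod post) ⟩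
  # u * (# s * (#prod pre * #prod post)) ∎
  where
  open ≡-Reasoning
  rearrange : ∀ S P U Q → S * (P * (U * Q)) ≡ U * (S * (P * Q))
  rearrange S P U Q = solve (S ∷ P ∷ U ∷ Q ∷ [])

#-C-in-C : ∀ u v x y t t₁ t₂ s₁ s₂ →
           # (C u v (C x y t t₁ t₂) s₁ s₂) ≡ # (C x y t (C u v t₁ s₁ s₂) (C u v t₂ s₁ s₂))
#-C-in-C u v x y t t₁ t₂ s₁ s₂ = distrib (# t) (# t₁) (# t₂) (# s₁) (# s₂)
  where
  distrib : ∀ a b c d e →
            2 * (2 * a * (b + c)) * (d + e) ≡ 2 * a * (2 * b * (d + e) + 2 * c * (d + e))
  distrib a b c d e = solve (a ∷ b ∷ c ∷ d ∷ e ∷ [])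

#-C-in-B : ∀ pre z x y t s₁ s₂ post s →
           # (B (pre ++ (z , C x y t s₁ s₂) ∷ post) s)
             ≡ # (C x y t (B (pre ++ (z , s₁) ∷ post) s) (B (pre ++ (z , s₂) ∷ post) s))
#-C-in-B pre z x y t s₁ s₂ post s = begin
  # (B (pre ++ (z , C x y t s₁ s₂) ∷ post) s) ≡⟨ #-B-plug pre z (C x y t s₁ s₂) post s ⟩
  2 * # t * (# s₁ + # s₂) * K                  ≡⟨ distrib (# t) (# s₁) (# s₂) K ⟩
  2 * # t * (# s₁ * K + # s₂ * K)              ≡⟨ cong₂ (λ m n → 2 * # t * (m + n))
                                                        (sym (#-B-plug pre z s₁ post s))
                                                        (sym (#-B-plug pre z s₂ post s)) ⟩
  2 * # t * (# (B (pre ++ (z , s₁) ∷ post) s) + # (B (pre ++ (z , s₂) ∷ post) s)) ∎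
  where
  open ≡-Reasoning
  K : ℕ
  K = # s * (#prod pre * #prod post)
  distrib : ∀ a b c k → 2 * a * (b + c) * k ≡ 2 * a * (b * k + c * k)
  distrib a b c k = solve (a ∷ b ∷ c ∷ k ∷ [])

mutual
  #prod-invariant : ∀ {xs ys} → xs >Pᴸ ys → #prod xs ≡ #prod ys
  #prod-invariant (here {xs = xs} r)    = cong (_* #prod xs) (lemma6 r)
  #prod-invariant (there {p = x , t} r) = cong (# t *_) (#prod-invariant r)

  lemma6 : ∀ {t s : Term} → t >P s → # t ≡ # s
  lemma6 p-app = refl
  lemma6 p-π₁ = refl
  lemma6 p-π₂ = refl
  lemma6 (p-C {u} {v} {x} {y} {t} {t₁} {t₂} {s₁} {s₂}) = #-C-in-C u v x y t t₁ t₂ s₁ s₂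
  lemma6 (p-B {pre} {post} {z} {x} {y} {t} {s₁} {s₂} {s}) = #-C-in-B pre z x y t s₁ s₂ post s
  lemma6 (c-lam r) = refl
  lemma6 (c-appˡ r) = lemma6 r
  lemma6 (c-appʳ r) = refl
  lemma6 (c-pairˡ r) = refl
  lemma6 (c-pairʳ r) = refl
  lemma6 (c-π₁ r) = lemma6 r
  lemma6 (c-π₂ r) = lemma6 r
  lemma6 (c-in₁ r) = refl
  lemma6 (c-in₂ r) = refl
  lemma6 (c-C₀ {t₁ = t₁} {t₂} r) = cong (λ m → 2 * m * (# t₁ + # t₂)) (lemma6 r)
  lemma6 (c-C₁ {t = t} {t₂ = t₂} r) = cong (λ m → 2 * # t * (m + # t₂)) (lemma6 r)
  lemma6 (c-C₂ {t = t} {t₁} r) = cong (λ m → 2 * # t * (# t₁ + m)) (lemma6 r)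
  lemma6 (c-Bᵢ {s = s} r) = cong (# s *_) (#prod-invariant r)
  lemma6 (c-Bin {xs = xs} r) = cong (_* #prod xs) (lemma6 r)
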